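{- Let $q$ be an indeterminate (or a nonzero complex number that is not a root of unity), let $a,b$ be parameters and $n\ge1$. Let $$w_n(x,a,b)=\prod_{j=0}^{n-1}\bigl(q^jx-[n]a-b\bigr),\qquad G_n(x,a,b)=(x-b)\prod_{j=1}^{n-1}\bigl(q^jx-[n]a-b\bigr).$$ Then $$G_n(x,a,b)=(1+aD)\,w_n(x,a,b).$$
   Context: $[n]=\frac{1-q^n}{1-q}$. $D$ is the $q$-differentiation operator in $x$: $Df(x)=\frac{f(x)-f(qx)}{(1-q)x}$. -}

module Defs where

open import Level using (_⊔_)
open import Data.Nat using (ℕ; zero; suc; _∸_)
open import Algebra.Bundles using (CommutativeRing)
open import Relation.Nullary using (¬_)
import Relation.Binary.Reasoning.Setoid as SetoidReasoning

record Field c ℓ : Set (Level.suc (c ⊔ ℓ)) where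
  field
    commutativeRing : CommutativeRing c ℓ
  open CommutativeRing commutativeRing public
  field
    0≉1    : ¬ (0# ≈ 1#)
    inv    : (x : Carrier) → ¬ (x ≈ 0#) → Carrier
    inv-law : (x : Carrier) (p : ¬ (x ≈ 0#)) → x * inv x p ≈ 1#

module FieldDefs {c ℓ} (F : Field c ℓ) where
  open Field F
  open SetoidReasoning setoid

  pow : Carrier → ℕ → Carrier
  pow y zero    = 1#
  pow y (suc n) = y * pow y n

  prod : (ℕ → Carrier) → ℕ → Carrier
  prod f zero    = 1#
  prod f (suc n) = prod f n * f n

  NotRootOfUnity : Carrier → Set ℓ
  NotRootOfUnity q = (m : ℕ) → ¬ (pow q (suc m) ≈ 1#)

  nru⇒1-q≉0 : {q : Carrier} → NotRootOfUnity q → ¬ ((1# - q) ≈ 0#)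
  nru⇒1-q≉0 {q} h e = h 0 (begin
      q * 1#              ≈⟨ *-identityʳ q ⟩
      q                   ≈⟨ sym (+-identityʳ q) ⟩
      q + 0#              ≈⟨ +-congˡ (sym e) ⟩
      q + (1# - q)        ≈⟨ +-comm q (1# - q) ⟩
      (1# + - q) + q      ≈⟨ +-assoc 1# (- q) q ⟩
      1# + (- q + q)      ≈⟨ +-congˡ (-‿inverseˡ q) ⟩
      1# + 0#             ≈⟨ +-identityʳ 1# ⟩
      1#                  ∎)

  mul≉0 : {u v : Carrier} → ¬ (u ≈ 0#) → ¬ (v ≈ 0#) → ¬ ((u * v) ≈ 0#)
  mul≉0 {u} {v} nu nv e = nv (begin
      v                   ≈⟨ sym (*-identityˡ v) ⟩
      1# * v              ≈⟨ *-congʳ (sym (inv-law u nu)) ⟩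
      (u * inv u nu) * v  ≈⟨ *-congʳ (*-comm u (inv u nu)) ⟩
      (inv u nu * u) * v  ≈⟨ *-assoc (inv u nu) u v ⟩
      inv u nu * (u * v)  ≈⟨ *-congˡ e ⟩
      inv u nu * 0#       ≈⟨ zeroʳ (inv u nu) ⟩
      0#                  ∎)

  qnum : (q : Carrier) → ¬ ((1# - q) ≈ 0#) → ℕ → Carrier
  qnum q p n = (1# - pow q n) * inv (1# - q) p

  qD : (q : Carrier) → ¬ ((1# - q) ≈ 0#) → (Carrier → Carrier) →
       (x : Carrier) → ¬ (x ≈ 0#) → Carrier
  qD q p f x nx = (f x - f (q * x)) * inv ((1# - q) * x) (mul≉0 p nx)

  wpoly : (q : Carrier) → ¬ ((1# - q) ≈ 0#) → ℕ → Carrier → Carrier → Carrier → Carrier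
  wpoly q p n a b x = prod (λ j → pow q j * x - qnum q p n * a - b) n

  Gpoly : (q : Carrier) → ¬ ((1# - q) ≈ 0#) → ℕ → Carrier → Carrier → Carrier → Carrier
  Gpoly q p n a b x = (x - b) * prod (λ j → pow q (suc j) * x - qnum q p n * a - b) (n ∸ 1)

-- Put u = [n] a and P = ∏_{j=1}^{n-1} (q^j x - u - b). Then w_n(x) = (x - u - b) P, and
-- substituting q x shifts every factor up by one, so w_n(q x) = P (q^n x - u - b).
-- Hence w_n(x) - w_n(q x) = (1 - q^n) x P and D w_n(x) = [n] P, so
-- (1 + a D) w_n(x) = (x - u - b) P + u P = (x - b) P = G_n(x).
module Submission where

open import Defs
open import Data.Nat using (ℕ; _≥_; zero; suc; _∸_)
open import Function using (_∘_)
open import Relation.Nullary using (¬_)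
open import Algebra.Bundles using (Ring)
import Relation.Binary.Reasoning.Setoid as SetoidReasoning

module _ {c ℓ} (F : Field c ℓ) where
  open Field F
  open FieldDefs F
  open SetoidReasoning setoid
  open import Algebra.Properties.AbelianGroup +-abelianGroup using (⁻¹-∙-comm)
  open import Algebra.Properties.CommutativeSemigroup +-commutativeSemigroup
    using (interchange; xy∙z≈xz∙y)
  open import Algebra.Properties.RingWithoutOne (Ring.ringWithoutOne ring)
    using (-‿distribˡ-*; x[y-z]≈xy-xz)

  x-y+y≈x : ∀ x y → (x - y) + y ≈ x
  x-y+y≈x x y = begin
    (x + - y) + y   ≈⟨ +-assoc x (- y) y ⟩
    x + (- y + y)   ≈⟨ +-congˡ (-‿inverseˡ y) ⟩
    x + 0#          ≈⟨ +-identityʳ x ⟩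
    x               ∎

  x-y-z+y≈x-z : ∀ x y z → ((x - y) - z) + y ≈ x - z
  x-y-z+y≈x-z x y z = trans (xy∙z≈xz∙y (x - y) (- z) y) (+-congʳ (x-y+y≈x x y))

  x+z-[y+z]≈x-y : ∀ x y z → (x + z) - (y + z) ≈ x - y
  x+z-[y+z]≈x-y x y z = begin
    (x + z) + - (y + z)     ≈⟨ +-congˡ (sym (⁻¹-∙-comm y z)) ⟩
    (x + z) + (- y + - z)   ≈⟨ interchange x z (- y) (- z) ⟩
    (x + - y) + (z + - z)   ≈⟨ +-congˡ (-‿inverseʳ z) ⟩
    (x + - y) + 0#          ≈⟨ +-identityʳ _ ⟩
    x - y                   ∎

  x-yx≈[1-y]x : ∀ x y → x - y * x ≈ (1# - y) * x
  x-yx≈[1-y]x x y = begin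
    x + - (y * x)           ≈⟨ +-cong (sym (*-identityˡ x)) (-‿distribˡ-* y x) ⟩
    1# * x + (- y) * x      ≈⟨ sym (distribʳ x 1# (- y)) ⟩
    (1# - y) * x            ∎

  x*inv[y*x]≈inv[y] : ∀ x y (x≉0 : ¬ (x ≈ 0#)) (y≉0 : ¬ (y ≈ 0#)) →
                      x * inv (y * x) (mul≉0 y≉0 x≉0) ≈ inv y y≉0
  x*inv[y*x]≈inv[y] x y x≉0 y≉0 = begin
    k                       ≈⟨ sym (*-identityˡ k) ⟩
    1# * k                  ≈⟨ *-congʳ (trans (sym (inv-law y y≉0)) (*-comm y y⁻¹)) ⟩
    (y⁻¹ * y) * k           ≈⟨ *-assoc y⁻¹ y k ⟩
    y⁻¹ * (y * k)           ≈⟨ *-congˡ (sym (*-assoc y x _)) ⟩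
    y⁻¹ * ((y * x) * inv (y * x) (mul≉0 y≉0 x≉0)) ≈⟨ *-congˡ (inv-law (y * x) (mul≉0 y≉0 x≉0)) ⟩
    y⁻¹ * 1#                ≈⟨ *-identityʳ y⁻¹ ⟩
    y⁻¹                     ∎
    where
    y⁻¹ = inv y y≉0
    k   = x * inv (y * x) (mul≉0 y≉0 x≉0)

  pow-suc-*ʳ : ∀ q j x → pow q j * (q * x) ≈ pow q (suc j) * x
  pow-suc-*ʳ q j x = trans (sym (*-assoc (pow q j) q x)) (*-congʳ (*-comm (pow q j) q))

  prod-cong : ∀ {f g : ℕ → Carrier} → (∀ j → f j ≈ g j) → ∀ m → prod f m ≈ prod g m
  prod-cong f≈g zero    = refl
  prod-cong f≈g (suc m) = *-cong (prod-cong f≈g m) (f≈g m)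

  prod-suc-head : ∀ (f : ℕ → Carrier) m → prod f (suc m) ≈ f 0 * prod (f ∘ suc) m
  prod-suc-head f zero    = trans (*-identityˡ (f 0)) (sym (*-identityʳ (f 0)))
  prod-suc-head f (suc m) = trans (*-congʳ (prod-suc-head f m)) (*-assoc _ _ _)

  qD-from-difference : ∀ q (1-q≉0 : ¬ ((1# - q) ≈ 0#)) (f : Carrier → Carrier)
                       x (x≉0 : ¬ (x ≈ 0#)) n y →
                       f x - f (q * x) ≈ y * ((1# - pow q n) * x) →
                       qD q 1-q≉0 f x x≉0 ≈ qnum q 1-q≉0 n * y
  qD-from-difference q 1-q≉0 f x x≉0 n y diff = begin
    (f x - f (q * x)) * k                ≈⟨ *-congʳ diff ⟩
    (y * ((1# - pow q n) * x)) * k       ≈⟨ *-assoc y _ k ⟩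
    y * (((1# - pow q n) * x) * k)       ≈⟨ *-congˡ (*-assoc (1# - pow q n) x k) ⟩
    y * ((1# - pow q n) * (x * k))       ≈⟨ *-congˡ (*-congˡ (x*inv[y*x]≈inv[y] x (1# - q) x≉0 1-q≉0)) ⟩
    y * qnum q 1-q≉0 n                   ≈⟨ *-comm y _ ⟩
    qnum q 1-q≉0 n * y                   ∎
    where k = inv ((1# - q) * x) (mul≉0 1-q≉0 x≉0)

  module _ (q : Carrier) (1-q≉0 : ¬ ((1# - q) ≈ 0#)) (n : ℕ) (a b : Carrier) where

    wfactor : Carrier → ℕ → Carrier
    wfactor x j = pow q j * x - qnum q 1-q≉0 n * a - b

    wtail : Carrier → Carrier
    wtail x = prod (wfactor x ∘ suc) (n ∸ 1)

  module _ (q : Carrier) (1-q≉0 : ¬ ((1# - q) ≈ 0#)) (m : ℕ) (a b : Carrier) (x : Carrier) where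

    private
      n = suc m
      u = qnum q 1-q≉0 n * a
      P = wtail q 1-q≉0 n a b x

    wpoly-≈-head*wtail : wpoly q 1-q≉0 n a b x ≈ ((x - u) - b) * P
    wpoly-≈-head*wtail =
      trans (prod-suc-head (wfactor q 1-q≉0 n a b x) m)
            (*-congʳ (+-congʳ (+-congʳ (*-identityˡ x))))

    wpoly-q*x-≈-wtail*last : wpoly q 1-q≉0 n a b (q * x) ≈ P * ((pow q n * x - u) - b)
    wpoly-q*x-≈-wtail*last =
      prod-cong (λ j → +-congʳ (+-congʳ (pow-suc-*ʳ q j x))) n

    wpoly-difference : wpoly q 1-q≉0 n a b x - wpoly q 1-q≉0 n a b (q * x)
                       ≈ P * ((1# - pow q n) * x)
    wpoly-difference = begin
      wpoly q 1-q≉0 n a b x - wpoly q 1-q≉0 n a b (q * x)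
        ≈⟨ +-cong (trans wpoly-≈-head*wtail (*-comm _ P)) (-‿cong wpoly-q*x-≈-wtail*last) ⟩
      P * ((x - u) - b) - P * ((pow q n * x - u) - b)
        ≈⟨ sym (x[y-z]≈xy-xz P _ _) ⟩
      P * (((x - u) - b) - ((pow q n * x - u) - b))
        ≈⟨ *-congˡ (x+z-[y+z]≈x-y (x - u) (pow q n * x - u) (- b)) ⟩
      P * ((x - u) - (pow q n * x - u))
        ≈⟨ *-congˡ (x+z-[y+z]≈x-y x (pow q n * x) (- u)) ⟩
      P * (x - pow q n * x)
        ≈⟨ *-congˡ (x-yx≈[1-y]x x (pow q n)) ⟩
      P * ((1# - pow q n) * x)
        ∎

    qD-wpoly : (x≉0 : ¬ (x ≈ 0#)) → qD q 1-q≉0 (wpoly q 1-q≉0 n a b) x x≉0 ≈ qnum q 1-q≉0 n * P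
    qD-wpoly x≉0 = qD-from-difference q 1-q≉0 (wpoly q 1-q≉0 n a b) x x≉0 n P wpoly-difference

    Gpoly-≈-wpoly+a*qD-wpoly : (x≉0 : ¬ (x ≈ 0#)) →
      Gpoly q 1-q≉0 n a b x ≈ wpoly q 1-q≉0 n a b x + a * qD q 1-q≉0 (wpoly q 1-q≉0 n a b) x x≉0
    Gpoly-≈-wpoly+a*qD-wpoly x≉0 = begin
      (x - b) * P                        ≈⟨ *-congʳ (sym (x-y-z+y≈x-z x u b)) ⟩
      (((x - u) - b) + u) * P            ≈⟨ distribʳ P ((x - u) - b) u ⟩
      ((x - u) - b) * P + u * P          ≈⟨ +-cong (sym wpoly-≈-head*wtail) u*P≈a*[n]P ⟩
      wpoly q 1-q≉0 n a b x + a * (qnum q 1-q≉0 n * P)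
                                         ≈⟨ +-congˡ (*-congˡ (sym (qD-wpoly x≉0))) ⟩
      wpoly q 1-q≉0 n a b x + a * qD q 1-q≉0 (wpoly q 1-q≉0 n a b) x x≉0 ∎
      where
      u*P≈a*[n]P : u * P ≈ a * (qnum q 1-q≉0 n * P)
      u*P≈a*[n]P = trans (*-congʳ (*-comm _ a)) (*-assoc a _ P)

mainTheorem5 : ∀ {c ℓ} (F : Field c ℓ) →
    let open Field F in
    let open FieldDefs F in
    (q a b : Carrier) → ¬ (q ≈ 0#) → (nru : NotRootOfUnity q) →
    (n : ℕ) → n ≥ 1 → (x : Carrier) → (nx : ¬ (x ≈ 0#)) →
    Gpoly q (nru⇒1-q≉0 nru) n a b x
      ≈ wpoly q (nru⇒1-q≉0 nru) n a b x
        + a * qD q (nru⇒1-q≉0 nru) (wpoly q (nru⇒1-q≉0 nru) n a b) x nx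
mainTheorem5 F q a b _ nru (suc m) _ x x≉0 =
  Gpoly-≈-wpoly+a*qD-wpoly F q (FieldDefs.nru⇒1-q≉0 F nru) m a b x x≉0
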